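{- Let $K\ge 0$ be an integer. Let $G_1,\ldots,G_n$ be nondeterministic automata, where $G_i$ has set of secret states $Q_i^S$, and consider the composed system $G_1\|\cdots\|G_n$ with interaction $\|_\land$, i.e. with set of secret states $Q^S=Q_1^S\times\cdots\times Q_n^S$. Let $\sim$ be an opaque observation equivalence on $G_1$ and $\tilde G_1$ the quotient automaton of $G_1$ modulo $\sim$. Then $G_1\|\cdots\|G_n$ is $K$-step opaque if and only if $\tilde G_1\|G_2\|\cdots\|G_n$ is $K$-step opaque (with secret states defined in the same $\|_\land$ manner).
   Context: An automaton is $G=\langle\Sigma_\tau,Q,\to,Q^\circ\rangle$ with finite set $\Sigma$ of observable events, a special unobservable event $\tau\notin\Sigma$, $\Sigma_\tau=\Sigma\cup\{\tau\}$, finite states $Q$, transitions $\to\subseteq Q\times\Sigma_\tau\times Q$, initial states $Q^\circ$; it carries secret states $Q^S\subseteq Q$ and $Q^{NS}=Q\setminus Q^S$. For $s\in\Sigma^*$, $p\stackrel{s}{\Rightarrow}q$ means there is $t\in\Sigma_\tau^*$ which becomes $s$ after deleting all $\tau$'s and $p\stackrel{t}{\to}q$; $p\stackrel{s}{\Rightarrow}$ means this for some $q$; $L(G,q)=\{s\in\Sigma^*:q\stackrel{s}{\Rightarrow}\}$. Synchronous composition: states are tuples, initial states products of initial states; an event in $\Sigma$ shared by components is executed jointly by all components having it in their alphabet; other events (including $\tau$, never shared) are executed by a single component while the others stay put. $K$-step opacity: $G$ is $K$-step opaque w.r.t. $Q^S$ iff for every $q^\circ\in Q^\circ$ and all $s,t\in\Sigma^*$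 with $st\in L(G,q^\circ)$, $q^\circ\stackrel{s}{\Rightarrow}Q^S$ and $|t|\le K$, there exist $q'^\circ\in Q^\circ$ and $y\in Q^{NS}$ with $q'^\circ\stackrel{s}{\Rightarrow}y$ and $y\stackrel{t}{\Rightarrow}$. Opaque observation equivalence: an equivalence relation $\sim$ on $Q$ such that whenever $x_1\sim x_2$: (i) if $x_1\stackrel{s}{\Rightarrow}y_1$ for some $s\in\Sigma^*$, then there is $y_2$ with $x_2\stackrel{s}{\Rightarrow}y_2$ and $y_1\sim y_2$; (ii) $x_1\in Q^S$ iff $x_2\in Q^S$. Quotient automaton modulo $\sim$: states are the classes $[x]$, $([x],\sigma,[y])$ is a transition iff $x'\stackrel{\sigma}{\to}y'$ for some $x'\in[x]$, $y'\in[y]$, initial states $\{[x^\circ]:x^\circ\in Q^\circ\}$; a class $[x]$ is secret iff $x\in Q^S$. -}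

module Defs where

open import Data.Nat using (ℕ; suc; _≤_)
open import Data.Fin using (Fin; zero; suc)
open import Data.Bool using (Bool; true; false)
open import Data.List using (List; []; _∷_; _++_; length)
open import Data.Product using (Σ; ∃; ∃-syntax; _×_; _,_)
open import Relation.Binary.PropositionalEquality using (_≡_; _≢_)
open import Relation.Binary using (Rel; IsEquivalence)
open import Relation.Nullary using (¬_)
open import Function.Bundles using (_⇔_)

data Lab (k : ℕ) : Set where
  τ  : Lab k
  ev : Fin k → Lab k

erase : ∀ {k} → List (Lab k) → List (Fin k)
erase []           = []
erase (τ ∷ t)      = erase t
erase (ev e ∷ t)   = e ∷ erase t

record LTS (k : ℕ) : Set₁ where
  field
    State  : Set
    step   : State → Lab k → State → Set
    init   : State → Set
    secret : State → Set

module _ {k : ℕ} (L : LTS k) where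
  open LTS L

  data Steps : State → List (Lab k) → State → Set where
    nil  : ∀ {p} → Steps p [] p
    cons : ∀ {p l q t r} → step p l q → Steps q t r → Steps p (l ∷ t) r

  WStep : State → List (Fin k) → State → Set
  WStep p s q = Σ (List (Lab k)) λ t → erase t ≡ s × Steps p t q

  WEnabled : State → List (Fin k) → Set
  WEnabled p s = ∃[ q ] WStep p s q

  KStepOpaque : ℕ → Set
  KStepOpaque K =
    ∀ (q° : State) → init q° → ∀ (s t : List (Fin k)) →
    WEnabled q° (s ++ t) →
    (∃[ q ] (WStep q° s q × secret q)) →
    length t ≤ K →
    ∃[ q'° ] ∃[ y ] (init q'° × ¬ secret y × WStep q'° s y × WEnabled y t)

-- A (nondeterministic) automaton over the global event set Fin k,
-- with finite state set Fin m, own alphabet Σ ⊆ Fin k (given by alph),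
-- transitions only on events of its alphabet or τ, initial and secret states.
record Automaton (k : ℕ) : Set₁ where
  field
    m      : ℕ
    alph   : Fin k → Bool
    trans  : Fin m → Lab k → Fin m → Set
    wf     : ∀ {x e y} → trans x (ev e) y → alph e ≡ true
    init   : Fin m → Set
    secret : Fin m → Set

toLTS : ∀ {k} → Automaton k → LTS k
toLTS G = record
  { State = Fin m ; step = trans ; init = init ; secret = secret }
  where open Automaton G

record IsOpaqueObsEquiv {k} (G : Automaton k)
       (_∼_ : Rel (Fin (Automaton.m G)) _) : Set where
  open Automaton G
  field
    isEquivalence : IsEquivalence _∼_
    simulate : ∀ {x₁ x₂} → x₁ ∼ x₂ → ∀ {s y₁} → WStep (toLTS G) x₁ s y₁ →
               ∃[ y₂ ] (WStep (toLTS G) x₂ s y₂ × y₁ ∼ y₂)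
    secret-resp : ∀ {x₁ x₂} → x₁ ∼ x₂ → (secret x₁ → secret x₂) × (secret x₂ → secret x₁)

-- G̃ is (up to renaming of states) the quotient automaton of G modulo ∼,
-- with π : x ↦ [x] the class map.
record IsQuotient {k} (G : Automaton k) (_∼_ : Rel (Fin (Automaton.m G)) _)
       (G̃ : Automaton k) (π : Fin (Automaton.m G) → Fin (Automaton.m G̃)) : Set where
  private
    module G = Automaton G
    module Q = Automaton G̃
  field
    π-surj   : ∀ a → ∃[ x ] (π x ≡ a)
    π-kernel : ∀ x y → (π x ≡ π y) ⇔ (x ∼ y)
    alph-eq  : ∀ e → Q.alph e ≡ G.alph e
    trans-eq : ∀ a σ b → Q.trans a σ b ⇔ (∃[ x' ] ∃[ y' ] (π x' ≡ a × π y' ≡ b × G.trans x' σ y'))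
    init-eq  : ∀ a → Q.init a ⇔ (∃[ x ] (π x ≡ a × G.init x))
    secret-eq : ∀ a → Q.secret a ⇔ (∃[ x ] (π x ≡ a × G.secret x))

Compose : ∀ {k n} → ((i : Fin n) → Automaton k) → LTS k
Compose {k} {n} G = record
  { State  = (i : Fin n) → Fin (Automaton.m (G i))
  ; step   = step
  ; init   = λ x → ∀ i → Automaton.init (G i) (x i)
  ; secret = λ x → ∀ i → Automaton.secret (G i) (x i)
  }
  where
  St = (i : Fin n) → Fin (Automaton.m (G i))
  step : St → Lab k → St → Set
  -- τ (never shared): exactly one component moves, the others stay put
  step x τ y = ∃[ i ] (Automaton.trans (G i) (x i) τ (y i) ×
                       (∀ j → j ≢ i → y j ≡ x j))
  step x (ev e) y =
    (∃[ i ] (Automaton.alph (G i) e ≡ true)) ×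
    (∀ i → (Automaton.alph (G i) e ≡ true → Automaton.trans (G i) (x i) (ev e) (y i)) ×
           (Automaton.alph (G i) e ≡ false → y i ≡ x i))

replace₀ : ∀ {k n} → ((i : Fin (suc n)) → Automaton k) → Automaton k →
           (i : Fin (suc n)) → Automaton k
replace₀ G H zero    = H
replace₀ G H (suc i) = G (suc i)

-- The argument is a bisimulation argument on the two composed systems.
--   1. Paths: concatenation of weak steps, and the splitting of a weak step
--      with a single visible event into  silent · event · silent.
--   2. Opacity transfer (for arbitrary labelled transition systems): call a
--      relation R an opacity bisimulation if it relates initial states both
--      ways, is a stepwise weak simulation in both directions and preserves
--      secrecy both ways.  Then K-step opacity transfers along R; since the
--      converse of an opacity bisimulation is again one, both directions of
--      the theorem come from this single lemma.
--   3. The quotient: every transition of the quotient from a class [a] is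
--      matched by a weak step from a itself (by the simulation property of
--      the opaque observation equivalence), and secrecy of [a] is that of a.
--   4. The composed systems: a state x of G₁‖⋯‖Gₙ is related to z of the
--      system with G̃₁ iff z agrees pointwise with x after mapping the first
--      component to its class.  Steps of the first system project, steps of
--      the second lift through the quotient facts; this gives an opacity
--      bisimulation, and the corollary follows from step 2.
module Submission where

open import Defs
open import Level using (0ℓ)
open import Data.Nat using (ℕ; suc)
open import Data.Fin using (Fin; zero; suc)
open import Data.Bool using (Bool; true; false)
open import Data.Bool.Properties using (not-¬)
open import Data.List using (List; []; _∷_; _++_)
open import Data.List.Properties using (∷-injective)
open import Data.Product using (∃-syntax; _×_; _,_; proj₁; proj₂)
open import Data.Empty using (⊥-elim)
open import Function using (flip)
open import Function.Bundles using (_⇔_; mk⇔; Equivalence)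
open import Relation.Binary using (Rel)
open import Relation.Binary.PropositionalEquality
  using (_≡_; refl; sym; trans; cong; subst)

open Equivalence using (to; from)

erase-++ : ∀ {k} (u v : List (Lab k)) → erase (u ++ v) ≡ erase u ++ erase v
erase-++ []         v = refl
erase-++ (τ ∷ u)    v = erase-++ u v
erase-++ (ev e ∷ u) v = cong (e ∷_) (erase-++ u v)

module Paths {k : ℕ} (L : LTS k) where
  open LTS L

  Steps-++ : ∀ {p u q v r} → Steps L p u q → Steps L q v r → Steps L p (u ++ v) r
  Steps-++ nil         ρ = ρ
  Steps-++ (cons σ ρ₁) ρ = cons σ (Steps-++ ρ₁ ρ)

  WStep-++ : ∀ {p s q s' r} → WStep L p s q → WStep L q s' r → WStep L p (s ++ s') r
  WStep-++ (u , refl , ρ) (v , refl , ρ') = u ++ v , erase-++ u v , Steps-++ ρ ρ'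

  single : ∀ {p l q} → step p l q → WStep L p (erase (l ∷ [])) q
  single σ = _ ∷ [] , refl , cons σ nil

  split-visible : ∀ {a e b} → WStep L a (e ∷ []) b →
    ∃[ a₁ ] ∃[ b₁ ] (WStep L a [] a₁ × step a₁ (ev e) b₁ × WStep L b₁ [] b)
  split-visible (.[] , () , nil)
  split-visible (τ ∷ v , eq , cons σ ρ) =
    let a₁ , b₁ , (u , eu , ρ₁) , σ₁ , rest = split-visible (v , eq , ρ)
    in  a₁ , b₁ , (τ ∷ u , eu , cons σ ρ₁) , σ₁ , rest
  split-visible (ev e' ∷ v , eq , cons σ ρ) with ∷-injective eq
  ... | refl , silent = _ , _ , ([] , refl , nil) , σ , (v , silent , ρ)

StepSimulation : ∀ {k} (A B : LTS k) → (LTS.State A → LTS.State B → Set) → Set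
StepSimulation A B R = ∀ {a b l a'} → R a b → LTS.step A a l a' →
                       ∃[ b' ] (WStep B b (erase (l ∷ [])) b' × R a' b')

weak-simulation : ∀ {k} {A B : LTS k} {R} → StepSimulation A B R →
  ∀ {a b s a'} → R a b → WStep A a s a' → ∃[ b' ] (WStep B b s b' × R a' b')
weak-simulation {k} {A} {B} {R} sim r (t , refl , ρ) = along r ρ
  where
  erase-∷ : ∀ l (t : List (Lab k)) → erase (l ∷ []) ++ erase t ≡ erase (l ∷ t)
  erase-∷ τ      t = refl
  erase-∷ (ev e) t = refl

  along : ∀ {a b t a'} → R a b → Steps A a t a' → ∃[ b' ] (WStep B b (erase t) b' × R a' b')
  along r nil = _ , ([] , refl , nil) , r
  along r (cons {l = l} {t = t} σ ρ) =
    let b₁ , w₁ , r₁ = sim r σ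
        b' , w₂ , r' = along r₁ ρ
    in  b' , subst (λ s → WStep B _ s b') (erase-∷ l t) (Paths.WStep-++ B w₁ w₂) , r'

record OpacityBisimulation {k} (A B : LTS k) (R : LTS.State A → LTS.State B → Set) : Set where
  private
    module A = LTS A
    module B = LTS B
  field
    init→   : ∀ {a} → A.init a → ∃[ b ] (B.init b × R a b)
    init←   : ∀ {b} → B.init b → ∃[ a ] (A.init a × R a b)
    step→   : StepSimulation A B R
    step←   : StepSimulation B A (flip R)
    secret→ : ∀ {a b} → R a b → A.secret a → B.secret b
    secret← : ∀ {a b} → R a b → B.secret b → A.secret a

converse : ∀ {k} {A B : LTS k} {R} → OpacityBisimulation A B R → OpacityBisimulation B A (flip R)
converse bis = record
  { init→ = init← ; init← = init→ ; step→ = step← ; step← = step→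
  ; secret→ = secret← ; secret← = secret→ }
  where open OpacityBisimulation bis

-- A secret run of
-- B is pulled back to A, where opacity supplies a non-secret run with the
-- same observation s that can continue with t; this run is pushed to B.
transfer : ∀ {k} {A B : LTS k} {R} → OpacityBisimulation A B R →
           ∀ K → KStepOpaque A K → KStepOpaque B K
transfer bis K opaque-A b° ib° s t (w , b°⇒w) (q , b°⇒q , secret-q) |t|≤K =
  let a° , ia° , Ra°b° = init← ib°
      w' , a°⇒w' , _   = weak-simulation step← Ra°b° b°⇒w
      q' , a°⇒q' , Rq'q = weak-simulation step← Ra°b° b°⇒q
      a'° , y , ia'° , ¬secret-y , a'°⇒y , (v , y⇒v) =
        opaque-A a° ia° s t (w' , a°⇒w') (q' , a°⇒q' , secret← Rq'q secret-q) |t|≤K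
      b'° , ib'° , Ra'°b'° = init→ ia'°
      y' , b'°⇒y' , Ryy'   = weak-simulation step→ Ra'°b'° a'°⇒y
      v' , y'⇒v' , _       = weak-simulation step→ Ryy' y⇒v
  in  b'° , y' , ib'° , (λ secret-y' → ¬secret-y (secret← Ryy' secret-y')) , b'°⇒y' , (v' , y'⇒v')
  where open OpacityBisimulation bis

module QuotientFacts {k} {G : Automaton k} {_∼_ : Rel (Fin (Automaton.m G)) 0ℓ}
  (O : IsOpaqueObsEquiv G _∼_)
  {G̃ : Automaton k} {π : Fin (Automaton.m G) → Fin (Automaton.m G̃)}
  (Qt : IsQuotient G _∼_ G̃ π) where
  private
    module G = Automaton G
    module Q = Automaton G̃
  open IsQuotient Qt
  open IsOpaqueObsEquiv O

  π-step : ∀ {a l b} → G.trans a l b → Q.trans (π a) l (π b)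
  π-step {a} {l} {b} σ = from (trans-eq (π a) l (π b)) (a , b , refl , refl , σ)

  π-init : ∀ {a} → G.init a → Q.init (π a)
  π-init {a} ia = from (init-eq (π a)) (a , refl , ia)

  π-secret : ∀ {a} → G.secret a → Q.secret (π a)
  π-secret {a} sa = from (secret-eq (π a)) (a , refl , sa)

  π-secret⁻¹ : ∀ {a} → Q.secret (π a) → G.secret a
  π-secret⁻¹ {a} sπa =
    let x , πx≡πa , sx = to (secret-eq (π a)) sπa
    in  proj₁ (secret-resp (to (π-kernel x a) πx≡πa)) sx

  step-lift : ∀ {a l c} → Q.trans (π a) l c →
              ∃[ a' ] (WStep (toLTS G) a (erase (l ∷ [])) a' × π a' ≡ c)
  step-lift {a} {l} {c} σ =
    let x' , y' , πx'≡πa , πy'≡c , σ' = to (trans-eq (π a) l c) σ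
        a' , a⇒a' , y'∼a' = simulate (to (π-kernel x' a) πx'≡πa) (Paths.single (toLTS G) σ')
    in  a' , a⇒a' , trans (sym (from (π-kernel y' a') y'∼a')) πy'≡c

module Pointwise {k n : ℕ} (H : Fin n → Automaton k) where
  open LTS (Compose H)

  _≐_ : State → State → Set
  x ≐ x' = ∀ i → x i ≡ x' i

  ≐-sym : ∀ {x x'} → x ≐ x' → x' ≐ x
  ≐-sym p i = sym (p i)

  step-resp : ∀ {x x' l y} → x ≐ x' → step x l y → step x' l y
  step-resp {l = τ} {y} p (i , σ , stay) =
    i , subst (λ c → Automaton.trans (H i) c τ (y i)) (p i) σ , λ j j≢i → trans (stay j j≢i) (p j)
  step-resp {l = ev e} {y} p (shared , move) = shared , λ i →
      (λ a → subst (λ c → Automaton.trans (H i) c (ev e) (y i)) (p i) (proj₁ (move i) a))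
    , (λ a → trans (proj₂ (move i) a) (p i))

module Replacement {k n : ℕ} (G : (i : Fin (suc n)) → Automaton k)
  {_∼_ : Rel (Fin (Automaton.m (G zero))) 0ℓ} (O : IsOpaqueObsEquiv (G zero) _∼_)
  (G̃ : Automaton k) (π : Fin (Automaton.m (G zero)) → Fin (Automaton.m G̃))
  (Qt : IsQuotient (G zero) _∼_ G̃ π) where
  private
    module G₀ = Automaton (G zero)
    module Q = Automaton G̃
  open IsQuotient Qt using (alph-eq; init-eq)
  open QuotientFacts O Qt
  open Pointwise G using (_≐_; ≐-sym; step-resp)
  open Pointwise (replace₀ G G̃) using ()
    renaming (_≐_ to _≐′_; ≐-sym to ≐′-sym; step-resp to step-resp′)

  C C' : LTS k
  C  = Compose G
  C' = Compose (replace₀ G G̃)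
  open LTS C using () renaming (State to St; step to stepC)
  open LTS C' using () renaming (State to St'; step to stepC')

  Others : Set
  Others = (i : Fin n) → Fin (Automaton.m (G (suc i)))

  others : St → Others
  others x i = x (suc i)

  others′ : St' → Others
  others′ z i = z (suc i)

  _◂_ : Fin G₀.m → Others → St
  (a ◂ v) zero    = a
  (a ◂ v) (suc i) = v i

  Π : St → St'
  Π x zero    = π (x zero)
  Π x (suc i) = x (suc i)

  Over : St → St' → Set
  Over x z = Π x ≐′ z

  participant→ : ∀ {e} → ∃[ i ] (Automaton.alph (G i) e ≡ true) →
                 ∃[ i ] (Automaton.alph (replace₀ G G̃ i) e ≡ true)
  participant→ {e} (zero  , a) = zero , trans (alph-eq e) a
  participant→     (suc i , a) = suc i , a

  participant← : ∀ {e} → ∃[ i ] (Automaton.alph (replace₀ G G̃ i) e ≡ true) →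
                 ∃[ i ] (Automaton.alph (G i) e ≡ true)
  participant← {e} (zero  , a) = zero , trans (sym (alph-eq e)) a
  participant←     (suc i , a) = suc i , a

  Π-step : ∀ {x l y} → stepC x l y → stepC' (Π x) l (Π y)
  Π-step {l = τ} (zero , σ , stay) =
    zero , π-step σ , λ { zero 0≢0 → ⊥-elim (0≢0 refl) ; (suc j) j≢0 → stay (suc j) j≢0 }
  Π-step {l = τ} (suc i , σ , stay) =
    suc i , σ , λ { zero _ → cong π (stay zero (λ ())) ; (suc j) j≢i → stay (suc j) j≢i }
  Π-step {l = ev e} (shared , move) = participant→ shared , λ
    { zero    → (λ a → π-step (proj₁ (move zero) (trans (sym (alph-eq e)) a)))
              , (λ a → cong π (proj₂ (move zero) (trans (sym (alph-eq e)) a)))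
    ; (suc i) → move (suc i) }

  silent-lift : ∀ {x b} → WStep (toLTS (G zero)) (x zero) [] b →
                ∃[ y ] (WStep C x [] y × y ≐ (b ◂ others x))
  silent-lift {x} (.[] , refl , nil) = x , ([] , refl , nil) , λ { zero → refl ; (suc i) → refl }
  silent-lift {x} (τ ∷ u , eu , cons {q = c} σ ρ) =
    let y , (v , silent , ρ') , y≐ = silent-lift {x = c ◂ others x} (u , eu , ρ)
        σ' = zero , σ , λ { zero 0≢0 → ⊥-elim (0≢0 refl) ; (suc j) _ → refl }
    in  y , (τ ∷ v , silent , cons σ' ρ') , y≐
  silent-lift (ev e ∷ u , () , _)

  joint-step : ∀ {x e w a b} → stepC' (Π x) (ev e) w →
               (G₀.alph e ≡ true → G₀.trans a (ev e) b) → (G₀.alph e ≡ false → b ≡ a) →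
               stepC (a ◂ others x) (ev e) (b ◂ others′ w)
  joint-step (shared , move) moves stays =
    participant← shared , λ { zero → moves , stays ; (suc i) → move (suc i) }

  -- Transitions of the replaced composition lift to weak steps of the
  -- original: the first component moves through the quotient (step-lift),
  -- the other components move as they do.
  lift-step : ∀ {x l w} → stepC' (Π x) l w → ∃[ y ] (WStep C x (erase (l ∷ [])) y × Over y w)
  lift-step {x} {τ} (zero , σ , stay) =
    let a' , x₀⇒a' , πa'≡w₀ = step-lift σ
        y , x⇒y , y≐ = silent-lift x₀⇒a'
    in  y , x⇒y , λ { zero    → trans (cong π (y≐ zero)) πa'≡w₀
                    ; (suc i) → trans (y≐ (suc i)) (sym (stay (suc i) λ ())) }
  lift-step {x} {τ} {w} (suc i , σ , stay) =
      x zero ◂ others′ w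
    , Paths.single C {l = τ} (suc i , σ , λ { zero _ → refl ; (suc j) j≢i → stay (suc j) j≢i })
    , λ { zero → sym (stay zero λ ()) ; (suc j) → refl }
  lift-step {x} {ev e} σ = lift-event σ (G₀.alph e) refl
    where
    lift-event : ∀ {w} → stepC' (Π x) (ev e) w → (b : Bool) → G₀.alph e ≡ b →
                 ∃[ y ] (WStep C x (e ∷ []) y × Over y w)
    lift-event {w} σ@(_ , move) false e∉ =
      let σ' = joint-step {a = x zero} σ (λ e∈ → ⊥-elim (not-¬ e∈ e∉)) (λ _ → refl)
      in  x zero ◂ others′ w
        , Paths.single C {l = ev e} (step-resp {l = ev e} (λ { zero → refl ; (suc i) → refl }) σ')
        , λ { zero    → sym (proj₂ (move zero) (trans (alph-eq e) e∉))
            ; (suc i) → refl }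
    lift-event {w} σ@(_ , move) true e∈ =
      let a' , x₀⇒a' , πa'≡w₀ = step-lift (proj₁ (move zero) (trans (alph-eq e) e∈))
          a₁ , b₁ , x₀⇒a₁ , a₁→b₁ , b₁⇒a' = Paths.split-visible (toLTS (G zero)) x₀⇒a'
          y₁ , x⇒y₁ , y₁≐ = silent-lift x₀⇒a₁
          y , b₁⇒y , y≐ = silent-lift {x = b₁ ◂ others′ w} b₁⇒a'
          σ' = joint-step σ (λ _ → a₁→b₁) (λ e∉ → ⊥-elim (not-¬ e∈ e∉))
          y₁→ = Paths.single C {l = ev e} (step-resp {l = ev e} (≐-sym y₁≐) σ')
      in  y
        , Paths.WStep-++ C x⇒y₁ (Paths.WStep-++ C y₁→ b₁⇒y)
        , λ { zero → trans (cong π (y≐ zero)) πa'≡w₀ ; (suc i) → y≐ (suc i) }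

  bisimulation : OpacityBisimulation C C' Over
  bisimulation = record
    { init→   = λ {x} ix → Π x , (λ { zero → π-init (ix zero) ; (suc i) → ix (suc i) }) , (λ _ → refl)
    ; init←   = init←
    ; step→   = λ {_} {_} {l} {y} x≐z σ → Π y , Paths.single C' {l = l} (step-resp′ x≐z (Π-step σ)) , (λ _ → refl)
    ; step←   = λ x≐z σ → lift-step (step-resp′ (≐′-sym x≐z) σ)
    ; secret→ = secret→
    ; secret← = secret←
    }
    where
    init← : ∀ {z} → LTS.init C' z → ∃[ x ] (LTS.init C x × Over x z)
    init← {z} iz =
      let a , πa≡z₀ , ia = to (init-eq (z zero)) (iz zero)
      in  a ◂ others′ z , (λ { zero → ia ; (suc i) → iz (suc i) }) , λ { zero → πa≡z₀ ; (suc i) → refl }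

    secret→ : ∀ {x z} → Over x z → LTS.secret C x → LTS.secret C' z
    secret→ x≐z sx zero    = subst Q.secret (x≐z zero) (π-secret (sx zero))
    secret→ x≐z sx (suc i) = subst (Automaton.secret (G (suc i))) (x≐z (suc i)) (sx (suc i))

    secret← : ∀ {x z} → Over x z → LTS.secret C' z → LTS.secret C x
    secret← x≐z sz zero    = π-secret⁻¹ (subst Q.secret (sym (x≐z zero)) (sz zero))
    secret← x≐z sz (suc i) = subst (Automaton.secret (G (suc i))) (sym (x≐z (suc i))) (sz (suc i))

corollary7 : ∀ {k n : ℕ} (K : ℕ) (G : (i : Fin (suc n)) → Automaton k)
    (_∼_ : Rel (Fin (Automaton.m (G zero))) _) → IsOpaqueObsEquiv (G zero) _∼_ →
    (G̃ : Automaton k) (π : Fin (Automaton.m (G zero)) → Fin (Automaton.m G̃)) →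
    IsQuotient (G zero) _∼_ G̃ π →
    KStepOpaque (Compose G) K ⇔ KStepOpaque (Compose (replace₀ G G̃)) K
corollary7 K G _∼_ O G̃ π Qt =
  mk⇔ (transfer bisimulation K) (transfer (converse bisimulation) K)
  where open Replacement G O G̃ π Qt
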